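{- For every $k\ge 2$, $S_k = A_kB_kA_kA_k$ where $A_k = S_{k-2}$ and $B_k=\widehat{A_k}$. Moreover, $A_k = A_{k-1}B_{k-1}$ and $B_k = A_{k-1}A_{k-1}$ for every $k\ge 3$.
   Context: Strings are over the binary alphabet $\{a,b\}$. For $c\in\{a,b\}$, $\overline{c}$ is the other letter; for a nonempty string $w$, $\widehat{w} = w[1..|w|-1]\cdot\overline{w[|w|]}$. The period-doubling sequences are $S_0=a$ and $S_k = \phi(S_{k-1})$ for $k\ge1$, where $\phi$ is the morphism with $\phi(a)=ab$, $\phi(b)=aa$; equivalently $S_k=S_{k-1}\widehat{S_{k-1}}$. -}

module Defs where

open import Data.Nat using (ℕ; zero; suc; _∸_)
open import Data.List using (List; []; _∷_; _++_; concatMap)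

data Letter : Set where
  a b : Letter

flip : Letter → Letter
flip a = b
flip b = a

-- w-hat: flip the last letter (only meaningful for nonempty w; [] ↦ [])
hat : List Letter → List Letter
hat [] = []
hat (c ∷ []) = flip c ∷ []
hat (c ∷ d ∷ w) = c ∷ hat (d ∷ w)

φ₁ : Letter → List Letter
φ₁ a = a ∷ b ∷ []
φ₁ b = a ∷ a ∷ []

φ : List Letter → List Letter
φ = concatMap φ₁

S : ℕ → List Letter
S zero = a ∷ []
S (suc k) = φ (S k)

A : ℕ → List Letter
A k = S (k ∸ 2)

B : ℕ → List Letter
B k = hat (A k)

-- Since φ(c) always begins with a and φ(flip c) = hat (φ c), the morphism φ
-- commutes with hat.  Applying φ to S₁ = S₀ hat(S₀) and to hat(S₁) = S₀ S₀
-- propagates both identities to every level, so S_{k+2} = S_k hat(S_k) S_k S_k.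
module Submission where

open import Defs
open import Data.Nat using (ℕ; _≤_; _∸_; suc; zero; s≤s; z≤n)
open import Data.List using ([]; _∷_; _++_; _∷ʳ_; [_]; initLast; InitLast)
open import Data.List.Properties using (++-assoc; concatMap-++)
open import Data.Product using (_×_; _,_)
open import Relation.Binary.PropositionalEquality using (_≡_; refl; cong; cong₂; sym; module ≡-Reasoning)

open InitLast

hat-++ : ∀ u c v → hat (u ++ c ∷ v) ≡ u ++ hat (c ∷ v)
hat-++ [] c v = refl
hat-++ (x ∷ []) c v = refl
hat-++ (x ∷ y ∷ u) c v = cong (x ∷_) (hat-++ (y ∷ u) c v)

hat-++-φ₁ : ∀ u c → hat (u ++ φ₁ c) ≡ u ++ φ₁ (flip c)
hat-++-φ₁ u a = hat-++ u a [ b ]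
hat-++-φ₁ u b = hat-++ u a [ a ]

φ-++ : ∀ u v → φ (u ++ v) ≡ φ u ++ φ v
φ-++ = concatMap-++ φ₁

φ-∷ʳ : ∀ u c → φ (u ∷ʳ c) ≡ φ u ++ φ₁ c
φ-∷ʳ u a = φ-++ u [ a ]
φ-∷ʳ u b = φ-++ u [ b ]

φ-hat : ∀ w → φ (hat w) ≡ hat (φ w)
φ-hat w with initLast w
... | [] = refl
... | u ∷ʳ′ c = begin
    φ (hat (u ∷ʳ c))       ≡⟨ cong φ (hat-++ u c []) ⟩
    φ (u ∷ʳ flip c)        ≡⟨ φ-∷ʳ u (flip c) ⟩
    φ u ++ φ₁ (flip c)     ≡⟨ sym (hat-++-φ₁ (φ u) c) ⟩
    hat (φ u ++ φ₁ c)      ≡⟨ cong hat (sym (φ-∷ʳ u c)) ⟩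
    hat (φ (u ∷ʳ c))       ∎
  where open ≡-Reasoning

S-suc : ∀ k → S (suc k) ≡ S k ++ hat (S k)
S-suc zero = refl
S-suc (suc k) = begin
    φ (S (suc k))                 ≡⟨ cong φ (S-suc k) ⟩
    φ (S k ++ hat (S k))          ≡⟨ φ-++ (S k) (hat (S k)) ⟩
    S (suc k) ++ φ (hat (S k))    ≡⟨ cong (S (suc k) ++_) (φ-hat (S k)) ⟩
    S (suc k) ++ hat (S (suc k))  ∎
  where open ≡-Reasoning

hat-S-suc : ∀ k → hat (S (suc k)) ≡ S k ++ S k
hat-S-suc zero = refl
hat-S-suc (suc k) = begin
    hat (φ (S (suc k)))   ≡⟨ sym (φ-hat (S (suc k))) ⟩
    φ (hat (S (suc k)))   ≡⟨ cong φ (hat-S-suc k) ⟩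
    φ (S k ++ S k)        ≡⟨ φ-++ (S k) (S k) ⟩
    S (suc k) ++ S (suc k) ∎
  where open ≡-Reasoning

S-suc-suc : ∀ k → S (suc (suc k)) ≡ S k ++ hat (S k) ++ S k ++ S k
S-suc-suc k = begin
    S (suc (suc k))                      ≡⟨ S-suc (suc k) ⟩
    S (suc k) ++ hat (S (suc k))         ≡⟨ cong₂ _++_ (S-suc k) (hat-S-suc k) ⟩
    (S k ++ hat (S k)) ++ S k ++ S k     ≡⟨ ++-assoc (S k) (hat (S k)) (S k ++ S k) ⟩
    S k ++ hat (S k) ++ S k ++ S k       ∎
  where open ≡-Reasoning

lemma3 : ((k : ℕ) → 2 ≤ k → S k ≡ A k ++ B k ++ A k ++ A k)
    × ((k : ℕ) → 3 ≤ k → (A k ≡ A (k ∸ 1) ++ B (k ∸ 1))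
    × (B k ≡ A (k ∸ 1) ++ A (k ∸ 1)))
lemma3 = factorisation , recursion
  where
  factorisation : (k : ℕ) → 2 ≤ k → S k ≡ A k ++ B k ++ A k ++ A k
  factorisation (suc (suc k)) (s≤s (s≤s z≤n)) = S-suc-suc k

  recursion : (k : ℕ) → 3 ≤ k → (A k ≡ A (k ∸ 1) ++ B (k ∸ 1))
                                × (B k ≡ A (k ∸ 1) ++ A (k ∸ 1))
  recursion (suc (suc (suc k))) (s≤s (s≤s (s≤s z≤n))) = S-suc k , hat-S-suc k
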